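{- Let $M'$ and $M''$ be two mixed trees with the same underlying graph. Then $M''$ can be obtained from $M'$ by a three-way switching (and vice versa).
   Context: A mixed multigraph $M=(V,E,A)$ is a finite loopless multigraph in which each edge is either undirected or an arc directed from an initial vertex to a terminal vertex; a mixed tree is one whose underlying (undirected) graph is a tree. Let $\omega=\frac12+\frac{\sqrt3}{2}\mathsf{i}$. The Hermitian adjacency matrix $N(M)=[N_{uv}]$ is defined by $N_{uv}=e\{u,v\}+e(u,v)\omega+e(v,u)\overline{\omega}$, where $e\{u,v\}$ is the number of undirected edges between $u$ and $v$ and $e(u,v)$ is the number of arcs directed from $u$ to $v$. $M''$ is obtained from $M'$ by a three-way switching if there is a diagonal matrix $D$ with every diagonal entry in $\{\omega^i:0\le i\le 5\}$ such that $N(M'')=D^{ -1}N(M')D$. -}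

module Defs where

open import Data.Nat as ℕ using (ℕ; zero; suc; _∸_)
open import Data.Integer as ℤ using (ℤ; +_; 0ℤ; 1ℤ)
open import Data.Fin using (Fin; toℕ)
open import Data.List using (List; []; _∷_; _∷ʳ_)
open import Data.List.Relation.Unary.Linked using (Linked)
open import Data.List.Relation.Unary.Unique.Propositional using (Unique)
open import Data.Product using (Σ; _×_; ∃)
open import Data.Sum using (_⊎_)
open import Data.Empty using (⊥)
open import Relation.Binary.PropositionalEquality using (_≡_)

-- Eisenstein integers ℤ[ω], ω = 1/2 + (√3/2) i, written a + b ω.
-- ω² = ω - 1, ω̄ = 1 - ω, ω⁶ = 1.  The basis {1, ω} makes this
-- representation canonical, so propositional equality is the right one.

record Eis : Set where
  constructor _+_ω
  field
    re : ℤ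
    im : ℤ
open Eis public

infixl 6 _+ᴱ_
infixl 7 _*ᴱ_

_+ᴱ_ : Eis → Eis → Eis
(a + b ω) +ᴱ (c + d ω) = (a ℤ.+ c) + (b ℤ.+ d) ω

-- (a + bω)(c + dω) = ac + (ad + bc)ω + bd ω² = (ac - bd) + (ad + bc + bd)... with ω² = ω - 1
_*ᴱ_ : Eis → Eis → Eis
(a + b ω) *ᴱ (c + d ω) =
  (a ℤ.* c ℤ.- b ℤ.* d) + (a ℤ.* d ℤ.+ b ℤ.* c ℤ.+ b ℤ.* d) ω

fromℕᴱ : ℕ → Eis
fromℕᴱ k = (+ k) + 0ℤ ω

oneᴱ : Eis
oneᴱ = 1ℤ + 0ℤ ω

ωᴱ : Eis
ωᴱ = 0ℤ + 1ℤ ω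

ω̄ᴱ : Eis
ω̄ᴱ = 1ℤ + ℤ.- 1ℤ ω

ωpow : ℕ → Eis
ωpow zero = oneᴱ
ωpow (suc k) = ωpow k *ᴱ ωᴱ

-- Mixed multigraphs on vertex set Fin n.
-- und u v = e{u,v} (number of undirected edges), arc u v = e(u,v).

record MixedGraph (n : ℕ) : Set where
  field
    und        : Fin n → Fin n → ℕ
    arc        : Fin n → Fin n → ℕ
    und-sym    : ∀ u v → und u v ≡ und v u
    und-noloop : ∀ u → und u u ≡ 0
    arc-noloop : ∀ u → arc u u ≡ 0
open MixedGraph public

N : ∀ {n} → MixedGraph n → Fin n → Fin n → Eis
N M u v = fromℕᴱ (und M u v) +ᴱ fromℕᴱ (arc M u v) *ᴱ ωᴱ +ᴱ fromℕᴱ (arc M v u) *ᴱ ω̄ᴱ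

mult : ∀ {n} → MixedGraph n → Fin n → Fin n → ℕ
mult M u v = und M u v ℕ.+ arc M u v ℕ.+ arc M v u

SameUnderlying : ∀ {n} → MixedGraph n → MixedGraph n → Set
SameUnderlying M₁ M₂ = ∀ u v → mult M₁ u v ≡ mult M₂ u v

Adj : ∀ {n} → MixedGraph n → Fin n → Fin n → Set
Adj M u v = 0 ℕ.< mult M u v

NoMultiEdges : ∀ {n} → MixedGraph n → Set
NoMultiEdges M = ∀ u v → mult M u v ℕ.≤ 1

Connected : ∀ {n} → MixedGraph n → Set
Connected M = ∀ u v → u ≡ v ⊎ ∃ λ xs → Linked (Adj M) (u ∷ xs ∷ʳ v)

-- acyclic: no cycle x, y, z, … (≥ 3 distinct vertices, consecutive adjacent,
-- last adjacent to first); 2-cycles are excluded by NoMultiEdges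
Acyclic : ∀ {n} → MixedGraph n → Set
Acyclic M = ∀ x y z rest → Unique (x ∷ y ∷ z ∷ rest) →
            Linked (Adj M) ((x ∷ y ∷ z ∷ rest) ∷ʳ x) → ⊥

IsMixedTree : ∀ {n} → MixedGraph n → Set
IsMixedTree M = NoMultiEdges M × Connected M × Acyclic M

-- three-way switching: N(M'') = D⁻¹ N(M') D, D = diag(ω^{d u}), d u ∈ {0..5};
-- D⁻¹ = diag(ω^{6 - d u}).
ThreeWaySwitching : ∀ {n} → MixedGraph n → MixedGraph n → Set
ThreeWaySwitching {n} M' M'' =
  Σ (Fin n → Fin 6) λ d →
    ∀ u v → N M'' u v ≡ ωpow (6 ∸ toℕ (d u)) *ᴱ N M' u v *ᴱ ωpow (toℕ (d v))

-- Give each edge uv of the tree M′ the label τ(u,v) = e″(u,v) − e′(u,v) ∈ ℤ/6, where N(M)uv = ω^{e(u,v)}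
-- on an edge; reversing an edge negates τ.  In a tree such a labelling is a coboundary: the sum d v of the
-- labels along a walk from a fixed root does not depend on the walk, because a walk reduces to the unique
-- path by cancelling back-and-forth steps (any other revisit would close a cycle).  Then τ(u,v) = d v − d u
-- on every edge, which says exactly that D = diag(ω^{d v}) switches M′ into M″.
module Submission where

open import Defs
open import Data.Nat using (ℕ)
open import Data.Product using (_×_)

open import Level using (0ℓ)
open import Algebra.Core using (Op₁; Op₂)
open import Algebra.Bundles using (Group; AbelianGroup)
open import Algebra.Structures using (IsGroup; IsAbelianGroup)
open import Data.Nat as ℕ using (zero; suc; _∸_)
open import Data.Nat.Properties using (≤-antisym; n≮0; n≤1⇒n≡0∨n≡1)
open import Data.Nat.DivMod using (_mod_)
open import Data.Integer as ℤ using (0ℤ)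
import Data.Integer.Properties as ℤ
open import Data.Fin using (Fin; toℕ; zero; #_)
open import Data.Fin.Properties using (_≟_; all?)
open import Data.List using (List; []; _∷_; _++_; _∷ʳ_; [_])
open import Data.List.Properties using (++-assoc)
open import Data.List.Relation.Unary.All as All using ([]; _∷_)
open import Data.List.Relation.Unary.All.Properties using (¬Any⇒All¬; ++⁻ˡ)
open import Data.List.Relation.Unary.AllPairs as AllPairs using ([]; _∷_)
open import Data.List.Relation.Unary.Any using (here; there)
open import Data.List.Relation.Unary.Linked using (Linked; []; [-]; _∷_)
open import Data.List.Relation.Unary.Unique.Propositional using (Unique)
open import Data.List.Membership.Propositional using (_∈_)
open import Data.List.Membership.Propositional.Properties using (∈-∃++)
open import Data.Product using (∃; _,_; proj₁; proj₂)
open import Data.Sum using (_⊎_; inj₁; inj₂)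
open import Data.Empty using (⊥; ⊥-elim)
open import Relation.Nullary using (¬_; yes; no)
open import Relation.Nullary.Decidable using (toWitness; map′; _×-dec_)
open import Relation.Binary.Core using (Rel)
open import Relation.Binary.Definitions using (DecidableEquality; Irreflexive)
open import Relation.Binary.PropositionalEquality
  using (_≡_; _≢_; refl; sym; trans; cong; cong₂; subst; isEquivalence; module ≡-Reasoning)

module _ {A : Set} {R : Rel A 0ℓ} where

  Linked-++⁻ˡ : ∀ xs {ys} → Linked R (xs ++ ys) → Linked R xs
  Linked-++⁻ˡ []           _         = []
  Linked-++⁻ˡ (x ∷ [])     _         = [-]
  Linked-++⁻ˡ (x ∷ y ∷ xs) (r ∷ rs) = r ∷ Linked-++⁻ˡ (y ∷ xs) rs

  Linked-∷ʳ⁺ : ∀ xs {a c} → Linked R (xs ∷ʳ a) → R a c → Linked R (xs ∷ʳ a ∷ʳ c)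
  Linked-∷ʳ⁺ []           _        r = r ∷ [-]
  Linked-∷ʳ⁺ (x ∷ [])     (r ∷ _)  r′ = r ∷ r′ ∷ [-]
  Linked-∷ʳ⁺ (x ∷ y ∷ xs) (r ∷ rs) r′ = r ∷ Linked-∷ʳ⁺ (y ∷ xs) rs r′

Unique-++⁻ˡ : ∀ {A : Set} (xs : List A) {ys} → Unique (xs ++ ys) → Unique xs
Unique-++⁻ˡ []       _        = []
Unique-++⁻ˡ (x ∷ xs) (p ∷ ps) = ++⁻ˡ xs p ∷ Unique-++⁻ˡ xs ps

Cycle-free : {V : Set} → Rel V 0ℓ → Set
Cycle-free R = ∀ x y z rest → Unique (x ∷ y ∷ z ∷ rest) → Linked R ((x ∷ y ∷ z ∷ rest) ∷ʳ x) → ⊥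

module TreeCocycle
  {V : Set} (_≟_ : DecidableEquality V) {R : Rel V 0ℓ}
  (irrefl : Irreflexive _≡_ R) (acyclic : Cycle-free R)
  {G : Set} {_∙_ : Op₂ G} {ε : G} {_⁻¹ : Op₁ G} (isGroup : IsGroup _≡_ _∙_ ε _⁻¹)
  (τ : V → V → G) (τ-reverse : ∀ {a c} → R a c → τ c a ≡ τ a c ⁻¹)
  where

  open IsGroup isGroup using (assoc; identityˡ; identityʳ; inverseʳ)

  group : Group 0ℓ 0ℓ
  group = record { isGroup = isGroup }

  open import Algebra.Properties.Group group using (∙-cancelʳ)
  open import Data.List.Membership.DecPropositional _≟_ using (_∈?_)

  target : V → List V → V
  target a []       = a
  target a (x ∷ xs) = target x xs

  label : V → List V → G
  label a []       = ε
  label a (x ∷ xs) = τ a x ∙ label x xs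

  target∈ : ∀ a xs → target a xs ∈ a ∷ xs
  target∈ a []       = here refl
  target∈ a (x ∷ xs) = there (target∈ x xs)

  target-++ : ∀ a xs ys → target a (xs ++ ys) ≡ target (target a xs) ys
  target-++ a []       ys = refl
  target-++ a (x ∷ xs) ys = target-++ x xs ys

  label-++ : ∀ a xs ys → label a (xs ++ ys) ≡ label a xs ∙ label (target a xs) ys
  label-++ a []       ys = sym (identityˡ _)
  label-++ a (x ∷ xs) ys = begin
    τ a x ∙ label x (xs ++ ys)                       ≡⟨ cong (τ a x ∙_) (label-++ x xs ys) ⟩
    τ a x ∙ (label x xs ∙ label (target x xs) ys)    ≡⟨ assoc _ _ _ ⟨
    (τ a x ∙ label x xs) ∙ label (target x xs) ys    ∎
    where open ≡-Reasoning

  Linked-++⁺ : ∀ a xs {ys} → Linked R (a ∷ xs) → Linked R (target a xs ∷ ys) → Linked R (a ∷ xs ++ ys)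
  Linked-++⁺ a []       _        l′ = l′
  Linked-++⁺ a (x ∷ xs) (r ∷ rs) l′ = r ∷ Linked-++⁺ x xs rs l′

  adjacent-distinct : ∀ {a c} → R a c → a ≢ c
  adjacent-distinct r a≡c = irrefl a≡c r

  backtrack : ∀ {a c} → R a c → ∀ g → g ≡ τ a c ∙ (τ c a ∙ g)
  backtrack {a} {c} r g = begin
    g                              ≡⟨ identityˡ g ⟨
    ε ∙ g                          ≡⟨ cong (_∙ g) (inverseʳ (τ a c)) ⟨
    (τ a c ∙ (τ a c ⁻¹)) ∙ g       ≡⟨ assoc _ _ _ ⟩
    τ a c ∙ ((τ a c ⁻¹) ∙ g)       ≡⟨ cong (λ h → τ a c ∙ (h ∙ g)) (τ-reverse r) ⟨
    τ a c ∙ (τ c a ∙ g)            ∎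
    where open ≡-Reasoning

  closing-edge-makes-cycle : ∀ {c y a} ps →
    Linked R (c ∷ y ∷ ps ∷ʳ a) → Unique (c ∷ y ∷ ps ∷ʳ a) → ¬ R a c
  closing-edge-makes-cycle {c} {y} {a} []       l u r = acyclic c y a []         u (Linked-∷ʳ⁺ (c ∷ y ∷ []) l r)
  closing-edge-makes-cycle {c} {y} {a} (z ∷ ps) l u r = acyclic c y z (ps ∷ʳ a) u (Linked-∷ʳ⁺ (c ∷ y ∷ z ∷ ps) l r)

  path-revisiting-makes-cycle : ∀ {c y a} ps qs →
    Linked R (c ∷ y ∷ ps ++ a ∷ qs) → Unique (c ∷ y ∷ ps ++ a ∷ qs) → ¬ R a c
  path-revisiting-makes-cycle {c} {y} {a} ps qs l u =
    closing-edge-makes-cycle ps (Linked-++⁻ˡ (c ∷ y ∷ ps ∷ʳ a) (subst (Linked R) split l))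
                                (Unique-++⁻ˡ (c ∷ y ∷ ps ∷ʳ a) (subst Unique split u))
    where
    split : c ∷ y ∷ ps ++ a ∷ qs ≡ (c ∷ y ∷ ps ∷ʳ a) ++ qs
    split = cong (λ zs → c ∷ y ∷ zs) (sym (++-assoc ps [ a ] qs))

  record Shortcut (a : V) (w : List V) : Set where
    constructor shortcut
    field
      path      : List V
      linked    : Linked R (a ∷ path)
      unique    : Unique (a ∷ path)
      target-eq : target a path ≡ target a w
      label-eq  : label a path ≡ label a w

  extend : ∀ {a c w} → R a c → Shortcut c w → Shortcut a (c ∷ w)
  extend {a} {c} r (shortcut [] l u t≡ ℓ≡) =
    shortcut [ c ] (r ∷ [-]) ((adjacent-distinct r ∷ []) ∷ u) t≡ (cong (τ a c ∙_) ℓ≡)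
  extend {a} {c} r (shortcut (y ∷ q) (r′ ∷ l) u t≡ ℓ≡) with a ≟ y | a ∈? q
  ... | yes refl | _      = shortcut q l (AllPairs.tail u) t≡ (trans (backtrack r _) (cong (τ a c ∙_) ℓ≡))
  ... | no a≢y   | no a∉q =
    shortcut (c ∷ y ∷ q) (r ∷ r′ ∷ l) ((adjacent-distinct r ∷ a≢y ∷ ¬Any⇒All¬ q a∉q) ∷ u) t≡
             (cong (τ a c ∙_) ℓ≡)
  ... | no _     | yes a∈q with ∈-∃++ a∈q
  ...   | q₁ , q₂ , refl = ⊥-elim (path-revisiting-makes-cycle q₁ q₂ (r′ ∷ l) u r)

  shorten : ∀ a w → Linked R (a ∷ w) → Shortcut a w
  shorten a []      _        = shortcut [] [-] ([] ∷ []) refl refl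
  shorten a (c ∷ w) (r ∷ rs) = extend r (shorten c w rs)

  closed-label : ∀ a w → Linked R (a ∷ w) → target a w ≡ a → label a w ≡ ε
  closed-label a w l closed with shorten a w l
  ... | shortcut []      _ _        _  ℓ≡ = sym ℓ≡
  ... | shortcut (y ∷ q) _ (a∉ ∷ _) t≡ _  =
    ⊥-elim (All.lookup a∉ (target∈ y q) (sym (trans t≡ closed)))

  record Walk (a b : V) : Set where
    constructor walk
    field
      steps  : List V
      linked : Linked R (a ∷ steps)
      ends   : target a steps ≡ b

  weight : ∀ {a b} → Walk a b → G
  weight {a} P = label a (Walk.steps P)

  _▸_ : ∀ {a b c} → Walk a b → Walk b c → Walk a c
  _▸_ {a} (walk xs l refl) (walk ys l′ refl) = walk (xs ++ ys) (Linked-++⁺ a xs l l′) (target-++ a xs ys)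

  weight-▸ : ∀ {a b c} (P : Walk a b) (Q : Walk b c) → weight (P ▸ Q) ≡ weight P ∙ weight Q
  weight-▸ {a} (walk xs _ refl) (walk ys _ refl) = label-++ a xs ys

  weight-closed : ∀ {a} (P : Walk a a) → weight P ≡ ε
  weight-closed {a} (walk xs l closed) = closed-label a xs l closed

  edge : ∀ {u v} → R u v → Walk u v
  edge {v = v} r = walk [ v ] (r ∷ [-]) refl

  module _ (connected : ∀ u v → u ≡ v ⊎ ∃ λ xs → Linked R (u ∷ xs ∷ʳ v)) where

    route : ∀ u v → Walk u v
    route u v with connected u v
    ... | inj₁ refl     = walk [] [-] refl
    ... | inj₂ (xs , l) = walk (xs ∷ʳ v) l (target-++ u xs [ v ])

    weight-unique : ∀ {a b} (P Q : Walk a b) → weight P ≡ weight Q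
    weight-unique {a} {b} P Q = ∙-cancelʳ (weight back) (weight P) (weight Q) (begin
      weight P ∙ weight back   ≡⟨ weight-▸ P back ⟨
      weight (P ▸ back)        ≡⟨ weight-closed (P ▸ back) ⟩
      ε                        ≡⟨ weight-closed (Q ▸ back) ⟨
      weight (Q ▸ back)        ≡⟨ weight-▸ Q back ⟩
      weight Q ∙ weight back   ∎)
      where
      open ≡-Reasoning
      back : Walk b a
      back = route b a

    potential : V → ∃ λ (d : V → G) → ∀ {u v} → R u v → d v ≡ d u ∙ τ u v
    potential root = d , d-edge
      where
      d : V → G
      d v = weight (route root v)

      d-edge : ∀ {u v} → R u v → d v ≡ d u ∙ τ u v
      d-edge {u} {v} r = begin
        d v                                  ≡⟨ weight-unique (route root v) (route root u ▸ edge r) ⟩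
        weight (route root u ▸ edge r)       ≡⟨ weight-▸ (route root u) (edge r) ⟩
        d u ∙ (τ u v ∙ ε)                    ≡⟨ cong (d u ∙_) (identityʳ (τ u v)) ⟩
        d u ∙ τ u v                          ∎
        where open ≡-Reasoning

ℤ₆ : Set
ℤ₆ = Fin 6

infixl 6 _⊕_
infix  8 ⊖_

_⊕_ : ℤ₆ → ℤ₆ → ℤ₆
a ⊕ b = (toℕ a ℕ.+ toℕ b) mod 6

⊖_ : ℤ₆ → ℤ₆
⊖ a = (6 ∸ toℕ a) mod 6

ℤ₆-isAbelianGroup : IsAbelianGroup _≡_ _⊕_ zero ⊖_
ℤ₆-isAbelianGroup = record
  { isGroup = record
    { isMonoid = record
      { isSemigroup = record
        { isMagma = record { isEquivalence = isEquivalence ; ∙-cong = cong₂ _⊕_ }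
        ; assoc = toWitness {a? = all? λ x → all? λ y → all? λ z → (x ⊕ y) ⊕ z ≟ x ⊕ (y ⊕ z)} _
        }
      ; identity = toWitness {a? = all? λ x → zero ⊕ x ≟ x} _
                 , toWitness {a? = all? λ x → x ⊕ zero ≟ x} _
      }
    ; inverse = toWitness {a? = all? λ x → ⊖ x ⊕ x ≟ zero} _
              , toWitness {a? = all? λ x → x ⊕ ⊖ x ≟ zero} _
    ; ⁻¹-cong = cong ⊖_
    }
  ; comm = toWitness {a? = all? λ x → all? λ y → x ⊕ y ≟ y ⊕ x} _
  }

ℤ₆-abelianGroup : AbelianGroup 0ℓ 0ℓ
ℤ₆-abelianGroup = record { isAbelianGroup = ℤ₆-isAbelianGroup }

infix 4 _≟ᴱ_

_≟ᴱ_ : DecidableEquality Eis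
(a + b ω) ≟ᴱ (c + d ω) = map′ (λ (a≡c , b≡d) → cong₂ _+_ω a≡c b≡d) (λ { refl → refl , refl }) (a ℤ.≟ c ×-dec b ℤ.≟ d)

ωpow-conjugate : ∀ a x y → ωpow (toℕ x) ≡ ωpow (6 ∸ toℕ a) *ᴱ ωpow (toℕ y) *ᴱ ωpow (toℕ (a ⊕ (x ⊕ ⊖ y)))
ωpow-conjugate = toWitness {a? = all? λ a → all? λ x → all? λ y →
  ωpow (toℕ x) ≟ᴱ ωpow (6 ∸ toℕ a) *ᴱ ωpow (toℕ y) *ᴱ ωpow (toℕ (a ⊕ (x ⊕ ⊖ y)))} _

0ᴱ : Eis
0ᴱ = 0ℤ + 0ℤ ω

*ᴱ-zeroʳ : ∀ x → x *ᴱ 0ᴱ ≡ 0ᴱ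
*ᴱ-zeroʳ (a + b ω) rewrite ℤ.*-zeroʳ a | ℤ.*-zeroʳ b = refl

*ᴱ-zeroˡ : ∀ x → 0ᴱ *ᴱ x ≡ 0ᴱ
*ᴱ-zeroˡ (c + d ω) = refl

Adj-irrefl : ∀ {n} (M : MixedGraph n) → Irreflexive _≡_ (Adj M)
Adj-irrefl M {u} refl r rewrite und-noloop M u | arc-noloop M u = n≮0 r

data Single : ℕ → ℕ → ℕ → Set where
  undirected : Single 1 0 0
  forward    : Single 0 1 0
  backward   : Single 0 0 1

single : ∀ x y z → x ℕ.+ y ℕ.+ z ≡ 1 → Single x y z
single 1             0             0             _  = undirected
single 0             1             0             _  = forward
single 0             0             1             _  = backward
single 0             0             0             ()
single (suc (suc _)) _             _             ()
single 1             (suc _)       _             ()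
single 1             0             (suc _)       ()
single 0             (suc (suc _)) _             ()
single 0             1             (suc _)       ()
single 0             0             (suc (suc _)) ()

arcExponent : ∀ {n} → MixedGraph n → Fin n → Fin n → ℤ₆
arcExponent M u v with arc M u v | arc M v u
... | suc _ | _     = # 1
... | zero  | suc _ = # 5
... | zero  | zero  = # 0

N-single : ∀ {n} (M : MixedGraph n) u v → mult M u v ≡ 1 → N M u v ≡ ωpow (toℕ (arcExponent M u v))
N-single M u v h with und M u v | arc M u v | arc M v u | single (und M u v) (arc M u v) (arc M v u) h
... | _ | _ | _ | undirected = refl
... | _ | _ | _ | forward    = refl
... | _ | _ | _ | backward   = refl

arcExponent-reverse : ∀ {n} (M : MixedGraph n) u v → mult M u v ≡ 1 → arcExponent M v u ≡ ⊖ arcExponent M u v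
arcExponent-reverse M u v h with und M u v | arc M u v | arc M v u | single (und M u v) (arc M u v) (arc M v u) h
... | _ | _ | _ | undirected = refl
... | _ | _ | _ | forward    = refl
... | _ | _ | _ | backward   = refl

N-absent : ∀ {n} (M : MixedGraph n) u v → mult M u v ≡ 0 → N M u v ≡ 0ᴱ
N-absent M u v h with und M u v | arc M u v | arc M v u
N-absent M u v () | suc _ | _     | _
N-absent M u v () | 0     | suc _ | _
N-absent M u v () | 0     | 0     | suc _
N-absent M u v _  | 0     | 0     | 0     = refl

switching : ∀ {n} (M′ M″ : MixedGraph n) → IsMixedTree M′ → SameUnderlying M′ M″ → ThreeWaySwitching M′ M″
switching {zero}  _  _  _                              _    = (λ ()) , λ ()
switching {suc m} M′ M″ (simple , connected , acyclic) same = d , conjugate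
  where
  open IsAbelianGroup ℤ₆-isAbelianGroup using (isGroup)
  open import Algebra.Properties.AbelianGroup ℤ₆-abelianGroup using (⁻¹-∙-comm)

  mult′≡1 : ∀ {u v} → Adj M′ u v → mult M′ u v ≡ 1
  mult′≡1 {u} {v} r = ≤-antisym (simple u v) r

  mult″≡1 : ∀ {u v} → Adj M′ u v → mult M″ u v ≡ 1
  mult″≡1 {u} {v} r = trans (sym (same u v)) (mult′≡1 r)

  τ : Fin (suc m) → Fin (suc m) → ℤ₆
  τ u v = arcExponent M″ u v ⊕ ⊖ arcExponent M′ u v

  τ-reverse : ∀ {a c} → Adj M′ a c → τ c a ≡ ⊖ τ a c
  τ-reverse {a} {c} r rewrite arcExponent-reverse M″ a c (mult″≡1 r) | arcExponent-reverse M′ a c (mult′≡1 r) =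
    ⁻¹-∙-comm (arcExponent M″ a c) (⊖ arcExponent M′ a c)

  open TreeCocycle _≟_ (Adj-irrefl M′) acyclic isGroup τ τ-reverse using (potential)

  tree-potential : ∃ λ (d : Fin (suc m) → ℤ₆) → ∀ {u v} → Adj M′ u v → d v ≡ d u ⊕ τ u v
  tree-potential = potential connected zero

  d : Fin (suc m) → ℤ₆
  d = proj₁ tree-potential

  conjugate : ∀ u v → N M″ u v ≡ ωpow (6 ∸ toℕ (d u)) *ᴱ N M′ u v *ᴱ ωpow (toℕ (d v))
  conjugate u v with n≤1⇒n≡0∨n≡1 (simple u v)
  ... | inj₁ absent = begin
    N M″ u v                                            ≡⟨ N-absent M″ u v (trans (sym (same u v)) absent) ⟩
    0ᴱ                                                  ≡⟨ sym (*ᴱ-zeroˡ (ωpow (toℕ (d v)))) ⟩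
    0ᴱ *ᴱ ωpow (toℕ (d v))                              ≡⟨ cong (_*ᴱ ωpow (toℕ (d v))) (sym (*ᴱ-zeroʳ (ωpow (6 ∸ toℕ (d u))))) ⟩
    ωpow (6 ∸ toℕ (d u)) *ᴱ 0ᴱ *ᴱ ωpow (toℕ (d v))      ≡⟨ cong (λ x → ωpow (6 ∸ toℕ (d u)) *ᴱ x *ᴱ ωpow (toℕ (d v))) (sym (N-absent M′ u v absent)) ⟩
    ωpow (6 ∸ toℕ (d u)) *ᴱ N M′ u v *ᴱ ωpow (toℕ (d v)) ∎
    where open ≡-Reasoning
  ... | inj₂ present = begin
    N M″ u v                                            ≡⟨ N-single M″ u v (trans (sym (same u v)) present) ⟩
    ωpow (toℕ (e″))                                     ≡⟨ ωpow-conjugate (d u) e″ e′ ⟩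
    ωpow (6 ∸ toℕ (d u)) *ᴱ ωpow (toℕ e′) *ᴱ ωpow (toℕ (d u ⊕ τ u v))
      ≡⟨ cong₂ (λ x k → ωpow (6 ∸ toℕ (d u)) *ᴱ x *ᴱ ωpow (toℕ k)) (sym (N-single M′ u v present)) (sym (proj₂ tree-potential r)) ⟩
    ωpow (6 ∸ toℕ (d u)) *ᴱ N M′ u v *ᴱ ωpow (toℕ (d v)) ∎
    where
    open ≡-Reasoning
    e′ e″ : ℤ₆
    e′ = arcExponent M′ u v
    e″ = arcExponent M″ u v
    r : Adj M′ u v
    r = subst (0 ℕ.<_) (sym present) (ℕ.s≤s ℕ.z≤n)

lemma3p4 : ∀ (n : ℕ) (M' M'' : MixedGraph n) →
    IsMixedTree M' → IsMixedTree M'' → SameUnderlying M' M'' →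
    ThreeWaySwitching M' M'' × ThreeWaySwitching M'' M'
lemma3p4 n M' M'' tree' tree'' same = switching M' M'' tree' same , switching M'' M' tree'' (λ u v → sym (same u v))
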